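{- Let $S=\{n_1,n_2,\ldots,n_s\}$ be a set of integers with $2\le n_s<\cdots<n_2<n_1$, and let $\delta_{\mathcal D}(S)$ denote the minimum number of $\mathcal D$-edges of a mixed hypergraph that is a one-realization of $S$. Then $$\delta_{\mathcal D}(S)=\begin{cases}\frac{n_1(n_1-1)}{2}, & \text{if } n_1-1\notin S,\\[2pt] \frac{n_1(n_1-1)}{2}-1, & \text{if } n_1-1\in S.\end{cases}$$
   Context: A mixed hypergraph is a triple $\mathcal H=(X,\mathcal C,\mathcal D)$ where $X$ is a finite set and $\mathcal C,\mathcal D$ are families of subsets of $X$, called $\mathcal C$-edges and $\mathcal D$-edges. A proper $k$-coloring of $\mathcal H$ is a map from $X$ to a set of $k$ colors such that every $\mathcal C$-edge contains two vertices of a common color and every $\mathcal D$-edge contains two vertices of distinct colors; it is strict if all $k$ colors are used. Colorings are identified with the partitions of $X$ into color classes. The feasible set $\mathcal F(\mathcal H)$ is the set of all $k$ such that $\mathcal H$ has a strict $k$-coloring; for $k\in\mathcal F(\mathcal H)$, $r_k$ is the number of partitions of $X$ arising as strict $k$-colorings. $\mathcal H$ is a one-realization of a set $S$ of positive integers if $\mathcal F(\mathcal H)=S$ and $r_k=1$ for every $k\in S$. -}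

module Defs where

open import Data.Nat using (ℕ; _≤_; _>_; _∸_; _*_; _/_)
open import Data.Fin using (Fin)
open import Data.Fin.Subset using (Subset) renaming (_∈_ to _∈ₛ_)
open import Data.List using (List; _∷_; length)
open import Data.List.Relation.Unary.All using (All)
open import Data.List.Relation.Unary.Unique.Propositional using (Unique)
open import Data.List.Relation.Unary.Linked using (Linked)
open import Data.List.Membership.Propositional using (_∈_; _∉_)
open import Data.Product using (Σ; ∃; _×_)
open import Relation.Binary.PropositionalEquality using (_≡_; _≢_)
open import Function.Bundles using (_⇔_)

-- A mixed hypergraph (X, 𝒞, 𝒟) with X = Fin order.
-- The families 𝒞, 𝒟 are finite sets of subsets of X, represented as
-- duplicate-free lists.
record MixedHypergraph : Set where
  field
    order : ℕ
    𝒞 : List (Subset order)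
    𝒟 : List (Subset order)
    𝒞-unique : Unique 𝒞
    𝒟-unique : Unique 𝒟

open MixedHypergraph public

#𝒟 : MixedHypergraph → ℕ
#𝒟 H = length (𝒟 H)

module _ (H : MixedHypergraph) where
  private X = Fin (order H)

  CEdgeOK : {k : ℕ} → (X → Fin k) → Subset (order H) → Set
  CEdgeOK c E = Σ X λ x → Σ X λ y → x ∈ₛ E × y ∈ₛ E × x ≢ y × c x ≡ c y

  DEdgeOK : {k : ℕ} → (X → Fin k) → Subset (order H) → Set
  DEdgeOK c E = Σ X λ x → Σ X λ y → x ∈ₛ E × y ∈ₛ E × c x ≢ c y

  Proper : (k : ℕ) → (X → Fin k) → Set
  Proper k c = All (CEdgeOK c) (𝒞 H) × All (DEdgeOK c) (𝒟 H)

  Strict : (k : ℕ) → (X → Fin k) → Set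
  Strict k c = Proper k c × (∀ (j : Fin k) → ∃ λ x → c x ≡ j)

  Feasible : ℕ → Set
  Feasible k = Σ (X → Fin k) (Strict k)

  SamePartition : {k l : ℕ} → (X → Fin k) → (X → Fin l) → Set
  SamePartition c c' = ∀ x y → (c x ≡ c y) ⇔ (c' x ≡ c' y)

  UniquePartition : ℕ → Set
  UniquePartition k =
    Feasible k × (∀ (c c' : X → Fin k) → Strict k c → Strict k c' → SamePartition c c')

OneRealization : MixedHypergraph → List ℕ → Set
OneRealization H S =
  (∀ k → Feasible H k ⇔ (k ∈ S)) × (∀ k → k ∈ S → UniquePartition H k)

δ𝒟-is : List ℕ → ℕ → Set
δ𝒟-is S d =
  (Σ MixedHypergraph λ H → OneRealization H S × #𝒟 H ≡ d)
  × (∀ H → OneRealization H S → d ≤ #𝒟 H)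

-- Let c be the strict n₁-colouring of a one-realization and merge two of its
-- colours i < j.  The result still satisfies every 𝒞-edge and uses all n₁ − 1 colours, so
-- either some 𝒟-edge turns monochromatic -- and that edge then carries exactly the colours i
-- and j, so different pairs give different edges -- or the merge is a strict (n₁ − 1)-colouring.
-- The latter forces n₁ − 1 ∈ S, and by r_{n₁−1} = 1 it happens for at most one pair.
--
-- Take vertices a₀ … a_{n₁−1}, b₀ … b_{n₁−1}, the 𝒟-edges {aᵢ, bⱼ} for i < j
-- (without {a₀, b_{n₁−1}} if n₁ − 1 ∈ S), and as 𝒞-edges all triples on which no intended
-- colouring is rainbow; for r + 2 ∈ S that is aᵢ ↦ min(i, r), bⱼ ↦ min(j, r + 1).  For a proper colouring c let t be the first index with
-- c(a_t) ≠ c(b_t).  A few such triples around t show that c is a relabelling of the intended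
-- (t + 1)-colouring (or of the exceptional (n₁ − 1)-colouring), and that t + 1 ∈ S.

module Submission where

open import Defs
open import Data.Bool as Bool using (Bool; T; true; false; if_then_else_)
open import Data.Empty using (⊥; ⊥-elim)
open import Data.Unit using (tt)
open import Data.Nat
  using (ℕ; zero; suc; pred; _+_; _*_; _∸_; _/_; _⊓_; _≤_; _<_; _>_; z≤n; s≤s; s≤s⁻¹; z<s; >-nonZero; _≟_; _≤?_; _<?_)
open import Data.Nat.Properties
open import Data.Nat.DivMod using (m*n/n≡m)
open import Data.Nat.Solver using (module +-*-Solver)
open import Data.Fin as Fin using (Fin; toℕ; fromℕ<; punchIn; punchOut)
open import Data.Fin.Properties as Fin
  using (injective⇒≤; toℕ-fromℕ<; toℕ-injective; toℕ<n; fromℕ<-injective; punchOut-injective; punchOut-cong;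
         punchOut-punchIn; punchInᵢ≢i)
open import Data.Fin.Subset using (Subset; ⁅_⁆; _∪_) renaming (_∈_ to _∈ₛ_)
import Data.Fin.Subset.Properties as Subset
open import Data.List
  using (List; []; _∷_; length; lookup; map; _++_; upTo; filter; deduplicate; cartesianProduct; allFin)
open import Data.List.Properties
  using (length-++; length-map; length-upTo; length-filter; length-deduplicate; filter-notAll)
open import Data.List.Relation.Unary.All as All using (All; []; _∷_)
open import Data.List.Relation.Unary.All.Properties using (¬All⇒Any¬)
open import Data.List.Relation.Unary.Any as Any using (here)
open import Data.List.Relation.Unary.Any.Properties using (lookup-index)
open import Data.List.Relation.Unary.Linked using (Linked; [-]; _∷_)
open import Data.List.Relation.Unary.Linked.Properties using (Linked⇒All)
open import Data.List.Relation.Unary.Unique.Propositional using (Unique; []; _∷_)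
open import Data.List.Relation.Unary.Unique.Propositional.Properties as Unique using (upTo⁺)
open import Data.List.Relation.Unary.Unique.DecPropositional.Properties using (deduplicate-!)
open import Data.List.Membership.Propositional using (_∈_; _∉_)
open import Data.List.Membership.DecPropositional _≟_ using (_∈?_)
open import Data.List.Membership.Propositional.Properties
  using (∈-lookup; ∈-++⁻; ∈-++⁺ˡ; ∈-++⁺ʳ; ∈-map⁺; ∈-map⁻; ∈-upTo⁺; ∈-upTo⁻; ∈-filter⁺; ∈-filter⁻;
         ∈-deduplicate⁺; ∈-deduplicate⁻; ∈-cartesianProduct⁺; ∈-allFin)
open import Data.Vec.Properties using (≡-dec)
open import Data.Product using (Σ; ∃; _×_; _,_; proj₁; proj₂; map₂)
open import Data.Sum as Sum using (_⊎_; inj₁; inj₂; [_,_]′)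
open import Function using (_∘_; _$_; flip)
open import Function.Bundles using (Equivalence; _⇔_; mk⇔)
open import Function.Properties.Equivalence using () renaming (trans to ⇔-trans; sym to ⇔-sym)
open import Relation.Nullary using (¬_; Dec; yes; no; contradiction)
open import Relation.Nullary.Decidable using (_×-dec_; ¬?; T?; does; dec-true; dec-false)
open import Relation.Binary.Definitions using (DecidableEquality; Tri; tri<; tri≈; tri>)
open import Relation.Binary.PropositionalEquality

private variable A : Set

lookup-injective : {xs : List A} → Unique xs → ∀ {i j} → lookup xs i ≡ lookup xs j → i ≡ j
lookup-injective (_    ∷ _)   {Fin.zero}  {Fin.zero}  _  = refl
lookup-injective (x∉xs ∷ _)   {Fin.zero}  {Fin.suc j} eq = contradiction eq (All.lookup x∉xs (∈-lookup j))
lookup-injective (x∉xs ∷ _)   {Fin.suc i} {Fin.zero}  eq = contradiction (sym eq) (All.lookup x∉xs (∈-lookup i))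
lookup-injective (_    ∷ xs!) {Fin.suc i} {Fin.suc j} eq = cong Fin.suc (lookup-injective xs! eq)

unique⇒length≤ : {xs : List A} {k : ℕ} → Unique xs → (f : ∀ {x} → x ∈ xs → Fin k) →
                 (∀ {x y} (x∈ : x ∈ xs) (y∈ : y ∈ xs) → f x∈ ≡ f y∈ → x ≡ y) → length xs ≤ k
unique⇒length≤ xs! f f-injective =
  injective⇒≤ {f = f ∘ ∈-lookup} (lookup-injective xs! ∘ f-injective (∈-lookup _) (∈-lookup _))

surjective-factor⇒≤ : ∀ {X : Set} {k l} (c : X → Fin k) (p : X → Fin l) →
  (∀ j → ∃ λ x → c x ≡ j) → (∀ x y → p x ≡ p y → c x ≡ c y) → k ≤ l
surjective-factor⇒≤ c p c-surjective p⇒c = injective⇒≤ {f = p ∘ witness} λ {j} {j′} eq →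
  trans (sym (proj₂ (c-surjective j))) (trans (p⇒c _ _ eq) (proj₂ (c-surjective j′)))
  where witness = λ j → proj₁ (c-surjective j)

injective-up-to-suc : {f : ℕ → A} {t : ℕ} → (∀ {u w} → u < t → w < t → f u ≡ f w → u ≡ w) →
                      (∀ {u} → u < t → f u ≢ f t) → ∀ {u w} → u < suc t → w < suc t → f u ≡ f w → u ≡ w
injective-up-to-suc {f = f} {t} injective fresh u<1+t w<1+t = cases (m<1+n⇒m<n∨m≡n u<1+t) (m<1+n⇒m<n∨m≡n w<1+t)
  where
  cases : ∀ {u w} → u < t ⊎ u ≡ t → w < t ⊎ w ≡ t → f u ≡ f w → u ≡ w
  cases (inj₁ u<t)  (inj₁ w<t)  eq = injective u<t w<t eq
  cases (inj₁ u<t)  (inj₂ refl) eq = contradiction eq (fresh u<t)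
  cases (inj₂ refl) (inj₁ w<t)  eq = contradiction (sym eq) (fresh w<t)
  cases (inj₂ refl) (inj₂ refl) _  = refl

first-failure : {P : ℕ → Set} → (∀ i → Dec (P i)) → ∀ k →
                (∀ {i} → i < k → P i) ⊎ ∃ λ t → t < k × (∀ {i} → i < t → P i) × ¬ P t
first-failure P? zero = inj₁ λ ()
first-failure P? (suc k) with first-failure P? k
... | inj₂ (t , t<k , below , ¬Pt) = inj₂ (t , m<n⇒m<1+n t<k , below , ¬Pt)
... | inj₁ below with P? k
...   | no ¬Pk = inj₂ (k , ≤-refl , below , ¬Pk)
...   | yes Pk = inj₁ λ i<1+k → [ below , (λ { refl → Pk }) ]′ (m<1+n⇒m<n∨m≡n i<1+k)

toℕ-≡fromℕ< : ∀ {n i} {u : Fin n} .{i<n : i < n} → u ≡ fromℕ< i<n → toℕ u ≡ i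
toℕ-≡fromℕ< refl = toℕ-fromℕ< _

pairs : ℕ → List (ℕ × ℕ)
pairs zero    = []
pairs (suc n) = map (_, n) (upTo n) ++ pairs n

∈-pairs⁻ : ∀ n {i j} → (i , j) ∈ pairs n → i < j × j < n
∈-pairs⁻ (suc n) p∈ with ∈-++⁻ (map (_, n) (upTo n)) p∈
... | inj₁ p∈new with _ , i∈ , refl ← ∈-map⁻ (_, n) p∈new = ∈-upTo⁻ i∈ , ≤-refl
... | inj₂ p∈old = map₂ m<n⇒m<1+n (∈-pairs⁻ n p∈old)

∈-pairs⁺ : ∀ n {i j} → i < j → j < n → (i , j) ∈ pairs n
∈-pairs⁺ (suc n) i<j j<1+n with m<1+n⇒m<n∨m≡n j<1+n
... | inj₁ j<n  = ∈-++⁺ʳ _ (∈-pairs⁺ n i<j j<n)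
... | inj₂ refl = ∈-++⁺ˡ (∈-map⁺ (_, n) (∈-upTo⁺ i<j))

pairs-unique : ∀ n → Unique (pairs n)
pairs-unique zero    = []
pairs-unique (suc n) = Unique.++⁺ (Unique.map⁺ (cong proj₁) (upTo⁺ n)) (pairs-unique n) disjoint
  where
  disjoint : ∀ {p} → ¬ (p ∈ map (_, n) (upTo n) × p ∈ pairs n)
  disjoint (p∈new , p∈old) with _ , _ , refl ← ∈-map⁻ (_, n) p∈new =
    <-irrefl refl (proj₂ (∈-pairs⁻ n p∈old))

length-pairs-suc : ∀ n → length (pairs (suc n)) ≡ n + length (pairs n)
length-pairs-suc n = begin
  length (map (_, n) (upTo n) ++ pairs n)          ≡⟨ length-++ (map (_, n) (upTo n)) ⟩
  length (map (_, n) (upTo n)) + length (pairs n)  ≡⟨ cong (_+ length (pairs n)) (trans (length-map _ (upTo n)) (length-upTo n)) ⟩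
  n + length (pairs n)                             ∎
  where open ≡-Reasoning

length-pairs-*2 : ∀ n → length (pairs n) * 2 ≡ n * (n ∸ 1)
length-pairs-*2 zero          = refl
length-pairs-*2 (suc zero)    = refl
length-pairs-*2 (suc (suc n)) = begin
  length (pairs (suc (suc n))) * 2          ≡⟨ cong (_* 2) (length-pairs-suc (suc n)) ⟩
  (suc n + length (pairs (suc n))) * 2      ≡⟨ *-distribʳ-+ 2 (suc n) _ ⟩
  suc n * 2 + length (pairs (suc n)) * 2    ≡⟨ cong (suc n * 2 +_) (length-pairs-*2 (suc n)) ⟩
  suc n * 2 + suc n * n                     ≡⟨ solve 1 (λ n → (con 1 :+ n) :* con 2 :+ (con 1 :+ n) :* n
                                                        := (con 2 :+ n) :* (con 1 :+ n)) refl n ⟩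
  suc (suc n) * suc n                       ∎
  where open ≡-Reasoning
        open +-*-Solver

length-pairs : ∀ n → length (pairs n) ≡ n * (n ∸ 1) / 2
length-pairs n = begin
  length (pairs n)               ≡⟨ m*n/n≡m (length (pairs n)) 2 ⟨
  length (pairs n) * 2 / 2       ≡⟨ cong (_/ 2) (length-pairs-*2 n) ⟩
  n * (n ∸ 1) / 2                ∎
  where open ≡-Reasoning

Endpoints : ℕ → ℕ → ℕ → ℕ → Set
Endpoints i j u v = (u ≡ i × v ≡ j) ⊎ (u ≡ j × v ≡ i)

endpoints-unique : ∀ {i j i′ j′ u v} → i < j → i′ < j′ →
                   Endpoints i j u v → Endpoints i′ j′ u v → (i , j) ≡ (i′ , j′)
endpoints-unique _   _     (inj₁ (refl , refl)) (inj₁ (refl , refl)) = refl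
endpoints-unique i<j i′<j′ (inj₁ (refl , refl)) (inj₂ (refl , refl)) = contradiction i<j (<-asym i′<j′)
endpoints-unique i<j i′<j′ (inj₂ (refl , refl)) (inj₁ (refl , refl)) = contradiction i<j (<-asym i′<j′)
endpoints-unique _   _     (inj₂ (refl , refl)) (inj₂ (refl , refl)) = refl

module Merge {k : ℕ} (i j : Fin (suc k)) (i≢j : i ≢ j) where

  merge : Fin (suc k) → Fin k
  merge x with x Fin.≟ j
  ... | yes _   = punchOut (i≢j ∘ sym)
  ... | no x≢j = punchOut (x≢j ∘ sym)

  merge-punchIn : ∀ x → merge (punchIn j x) ≡ x
  merge-punchIn x with punchIn j x Fin.≟ j
  ... | yes eq = contradiction eq (punchInᵢ≢i j x)
  ... | no _   = trans (punchOut-cong j refl) (punchOut-punchIn j)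

  merge-identifies : merge i ≡ merge j
  merge-identifies with i Fin.≟ j | j Fin.≟ j
  ... | yes i≡j | _     = contradiction i≡j i≢j
  ... | no _    | yes _ = punchOut-cong j refl
  ... | no _    | no j≢j = contradiction refl j≢j

  merge-collapses : ∀ {x y} → x ≢ y → merge x ≡ merge y → (x ≡ i × y ≡ j) ⊎ (x ≡ j × y ≡ i)
  merge-collapses {x} {y} x≢y eq with x Fin.≟ j | y Fin.≟ j
  ... | yes x≡j | yes y≡j = contradiction (trans x≡j (sym y≡j)) x≢y
  ... | yes x≡j | no y≢j  = inj₂ (x≡j , sym (punchOut-injective (i≢j ∘ sym) (y≢j ∘ sym) eq))
  ... | no x≢j  | yes y≡j = inj₁ (punchOut-injective (x≢j ∘ sym) (i≢j ∘ sym) eq , y≡j)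
  ... | no x≢j  | no y≢j  = contradiction (punchOut-injective (x≢j ∘ sym) (y≢j ∘ sym) eq) x≢y

module _ (H : MixedHypergraph) {k : ℕ} (c : Fin (order H) → Fin k) where

  CEdgeOK? : ∀ E → Dec (CEdgeOK H c E)
  CEdgeOK? E = Fin.any? λ x → Fin.any? λ y →
    (x Subset.∈? E) ×-dec (y Subset.∈? E) ×-dec ¬? (x Fin.≟ y) ×-dec (c x Fin.≟ c y)

  DEdgeOK? : ∀ E → Dec (DEdgeOK H c E)
  DEdgeOK? E = Fin.any? λ x → Fin.any? λ y →
    (x Subset.∈? E) ×-dec (y Subset.∈? E) ×-dec ¬? (c x Fin.≟ c y)

  ¬DEdgeOK⇒monochromatic : ∀ {E x y} → ¬ DEdgeOK H c E → x ∈ₛ E → y ∈ₛ E → c x ≡ c y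
  ¬DEdgeOK⇒monochromatic {x = x} {y} ¬ok x∈ y∈ with c x Fin.≟ c y
  ... | yes cx≡cy = cx≡cy
  ... | no cx≢cy  = contradiction (x , y , x∈ , y∈ , cx≢cy) ¬ok

-- The lower bound

module LowerBound {S : List ℕ} {H : MixedHypergraph} (R : OneRealization H S)
                  (m : ℕ) (1+m∈S : suc m ∈ S) where

  private
    X = Fin (order H)

    c : X → Fin (suc m)
    c = proj₁ (Equivalence.from (proj₁ R (suc m)) 1+m∈S)

    c-strict : Strict H (suc m) c
    c-strict = proj₂ (Equivalence.from (proj₁ R (suc m)) 1+m∈S)

  module _ {i j} (p∈ : (i , j) ∈ pairs (suc m)) where
    private
      i<j = proj₁ (∈-pairs⁻ (suc m) p∈)
      j<n = proj₂ (∈-pairs⁻ (suc m) p∈)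

    lo hi : Fin (suc m)
    lo = fromℕ< (<-trans i<j j<n)
    hi = fromℕ< j<n

    lo≢hi : lo ≢ hi
    lo≢hi = <⇒≢ i<j ∘ fromℕ<-injective _ _ _ _

    open Merge lo hi lo≢hi public

  merged : ∀ {i j} → (i , j) ∈ pairs (suc m) → X → Fin m
  merged p∈ = merge p∈ ∘ c

  merged-collapses : ∀ {i j x y} (p∈ : (i , j) ∈ pairs (suc m)) → c x ≢ c y →
                     merged p∈ x ≡ merged p∈ y → Endpoints i j (toℕ (c x)) (toℕ (c y))
  merged-collapses p∈ cx≢cy eq with merge-collapses p∈ cx≢cy eq
  ... | inj₁ (cx≡i , cy≡j) = inj₁ (toℕ-≡fromℕ< cx≡i , toℕ-≡fromℕ< cy≡j)
  ... | inj₂ (cx≡j , cy≡i) = inj₂ (toℕ-≡fromℕ< cx≡j , toℕ-≡fromℕ< cy≡i)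

  Violated : ∀ {i j} → (i , j) ∈ pairs (suc m) → Set
  Violated p∈ = Σ (Fin (#𝒟 H)) λ e → ¬ DEdgeOK H (merged p∈) (lookup (𝒟 H) e)

  violated-or-strict : ∀ {i j} (p∈ : (i , j) ∈ pairs (suc m)) → Violated p∈ ⊎ Strict H m (merged p∈)
  violated-or-strict p∈ with All.all? (DEdgeOK? H (merged p∈)) (𝒟 H)
  ... | no ¬all = let e = ¬All⇒Any¬ (DEdgeOK? H (merged p∈)) (𝒟 H) ¬all in
                  inj₁ (Any.index e , lookup-index e)
  ... | yes all = inj₂ ((All.map merged-CEdgeOK (proj₁ (proj₁ c-strict)) , all) , merged-surjective)
    where
    merged-CEdgeOK : ∀ {E} → CEdgeOK H c E → CEdgeOK H (merged p∈) E
    merged-CEdgeOK (x , y , x∈ , y∈ , x≢y , cx≡cy) = x , y , x∈ , y∈ , x≢y , cong (merge p∈) cx≡cy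
    merged-surjective : ∀ t → ∃ λ x → merged p∈ x ≡ t
    merged-surjective t with x , cx≡ ← proj₂ c-strict (punchIn (hi p∈) t) =
      x , trans (cong (merge p∈) cx≡) (merge-punchIn p∈ t)

  violated-edge-determines-pair : ∀ {i j i′ j′} (p∈ : (i , j) ∈ pairs (suc m)) (q∈ : (i′ , j′) ∈ pairs (suc m)) →
    (v : Violated p∈) (w : Violated q∈) → proj₁ v ≡ proj₁ w → (i , j) ≡ (i′ , j′)
  violated-edge-determines-pair p∈ q∈ (e , ¬ok) (.e , ¬ok′) refl
    with x , y , x∈ , y∈ , cx≢cy ← All.lookup (proj₂ (proj₁ c-strict)) (∈-lookup e) =
    endpoints-unique (proj₁ (∈-pairs⁻ (suc m) p∈)) (proj₁ (∈-pairs⁻ (suc m) q∈))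
      (merged-collapses p∈ cx≢cy (¬DEdgeOK⇒monochromatic H _ ¬ok x∈ y∈))
      (merged-collapses q∈ cx≢cy (¬DEdgeOK⇒monochromatic H _ ¬ok′ x∈ y∈))

  strict-merge-determines-pair : m ∈ S → ∀ {i j i′ j′} (p∈ : (i , j) ∈ pairs (suc m)) (q∈ : (i′ , j′) ∈ pairs (suc m)) →
    Strict H m (merged p∈) → Strict H m (merged q∈) → (i , j) ≡ (i′ , j′)
  strict-merge-determines-pair m∈S p∈ q∈ p-strict q-strict
    with x , cx≡lo ← proj₂ c-strict (lo p∈) | y , cy≡hi ← proj₂ c-strict (hi p∈) =
    endpoints-unique (proj₁ (∈-pairs⁻ (suc m) p∈)) (proj₁ (∈-pairs⁻ (suc m) q∈))
      (inj₁ (toℕ-≡fromℕ< cx≡lo , toℕ-≡fromℕ< cy≡hi))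
      (merged-collapses q∈ cx≢cy q-merges)
    where
    cx≢cy : c x ≢ c y
    cx≢cy eq = lo≢hi p∈ (trans (sym cx≡lo) (trans eq cy≡hi))
    p-merges : merged p∈ x ≡ merged p∈ y
    p-merges = begin
      merge p∈ (c x)    ≡⟨ cong (merge p∈) cx≡lo ⟩
      merge p∈ (lo p∈)  ≡⟨ merge-identifies p∈ ⟩
      merge p∈ (hi p∈)  ≡⟨ cong (merge p∈) cy≡hi ⟨
      merge p∈ (c y)    ∎
      where open ≡-Reasoning
    q-merges : merged q∈ x ≡ merged q∈ y
    q-merges = Equivalence.to (proj₂ (proj₂ R m m∈S) (merged p∈) (merged q∈) p-strict q-strict x y) p-merges

  violated : m ∉ S → ∀ {i j} (p∈ : (i , j) ∈ pairs (suc m)) → Violated p∈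
  violated m∉S p∈ with violated-or-strict p∈
  ... | inj₁ v      = v
  ... | inj₂ strict = contradiction (Equivalence.to (proj₁ R m) (merged p∈ , strict)) m∉S

  pairs≤#𝒟 : m ∉ S → length (pairs (suc m)) ≤ #𝒟 H
  pairs≤#𝒟 m∉S = unique⇒length≤ (pairs-unique (suc m)) (proj₁ ∘ violated m∉S)
    (λ p∈ q∈ → violated-edge-determines-pair p∈ q∈ (violated m∉S p∈) (violated m∉S q∈))

  pairs≤1+#𝒟 : m ∈ S → length (pairs (suc m)) ≤ suc (#𝒟 H)
  pairs≤1+#𝒟 m∈S = unique⇒length≤ (pairs-unique (suc m)) (λ p∈ → code p∈ (violated-or-strict p∈))
    (λ p∈ q∈ → code-injective p∈ q∈ (violated-or-strict p∈) (violated-or-strict q∈))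
    where
    code : ∀ {i j} (p∈ : (i , j) ∈ pairs (suc m)) → Violated p∈ ⊎ Strict H m (merged p∈) → Fin (suc (#𝒟 H))
    code _ (inj₁ (e , _)) = Fin.suc e
    code _ (inj₂ _)       = Fin.zero
    code-injective : ∀ {i j i′ j′} (p∈ : (i , j) ∈ pairs (suc m)) (q∈ : (i′ , j′) ∈ pairs (suc m)) →
      (o : Violated p∈ ⊎ Strict H m (merged p∈)) (o′ : Violated q∈ ⊎ Strict H m (merged q∈)) →
      code p∈ o ≡ code q∈ o′ → (i , j) ≡ (i′ , j′)
    code-injective p∈ q∈ (inj₁ v) (inj₁ w) eq = violated-edge-determines-pair p∈ q∈ v w (Fin.suc-injective eq)
    code-injective p∈ q∈ (inj₂ s) (inj₂ t) _  = strict-merge-determines-pair m∈S p∈ q∈ s t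

-- The construction

module Construction (m : ℕ) (S : List ℕ) (twisted : Bool)
  (S-bounds : All (λ K → 2 ≤ K × K ≤ suc (suc m)) S)
  (2+m∈S : suc (suc m) ∈ S)
  (1+m∈S : T twisted → suc m ∈ S) where

  n N : ℕ
  n = suc (suc m)
  N = n + n

  -- a i and b j are the vertices aᵢ and bⱼ, at positions i and n + j of Fin N; vertex sends
  -- out-of-range codes to the junk value zero.
  data Vertex : Set where
    a b : ℕ → Vertex

  InRange : Vertex → Set
  InRange (a i) = i < n
  InRange (b j) = j < n

  code : Vertex → ℕ
  code (a i) = i
  code (b j) = n + j

  code-< : ∀ {u} → InRange u → code u < N
  code-< {a i} i<n = <-≤-trans i<n (m≤m+n n n)
  code-< {b j} j<n = +-monoʳ-< n j<n

  code-injective : ∀ {u w} → InRange u → InRange w → code u ≡ code w → u ≡ w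
  code-injective {a i} {a .i} _   _   refl = refl
  code-injective {a i} {b j} i<n _   i≡n+j = contradiction (subst (_< n) i≡n+j i<n) (m+n≮m n j)
  code-injective {b j} {a i} _   i<n n+j≡i = contradiction (subst (_< n) (sym n+j≡i) i<n) (m+n≮m n j)
  code-injective {b j} {b k} _   _   n+j≡n+k = cong b (+-cancelˡ-≡ n j k n+j≡n+k)

  vertex : Vertex → Fin N
  vertex u with code u <? N
  ... | yes u<N = fromℕ< u<N
  ... | no _    = Fin.zero

  toℕ-vertex : ∀ {u} → InRange u → toℕ (vertex u) ≡ code u
  toℕ-vertex {u} u∈ with code u <? N
  ... | yes u<N = toℕ-fromℕ< u<N
  ... | no u≮N  = contradiction (code-< u∈) u≮N

  vertex-injective : ∀ {u w} → InRange u → InRange w → vertex u ≡ vertex w → u ≡ w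
  vertex-injective u∈ w∈ eq =
    code-injective u∈ w∈ (trans (sym (toℕ-vertex u∈)) (trans (cong toℕ eq) (toℕ-vertex w∈)))

  side : Fin N → Vertex
  side x with toℕ x <? n
  ... | yes _ = a (toℕ x)
  ... | no _  = b (toℕ x ∸ n)

  side-inRange : ∀ x → InRange (side x)
  side-inRange x with toℕ x <? n
  ... | yes x<n = x<n
  ... | no x≮n  = subst (toℕ x ∸ n <_) (m+n∸m≡n n n) (∸-monoˡ-< (toℕ<n x) (≮⇒≥ x≮n))

  code-side : ∀ x → code (side x) ≡ toℕ x
  code-side x with toℕ x <? n
  ... | yes _   = refl
  ... | no x≮n  = m+[n∸m]≡n (≮⇒≥ x≮n)

  vertex-side : ∀ x → vertex (side x) ≡ x
  vertex-side x = toℕ-injective (trans (toℕ-vertex (side-inRange x)) (code-side x))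

  side-vertex : ∀ {u} → InRange u → side (vertex u) ≡ u
  side-vertex u∈ = code-injective (side-inRange _) u∈ (trans (code-side _) (toℕ-vertex u∈))

  Pattern : Set
  Pattern = Vertex → ℕ

  -- π r is the intended colouring with r + 2 colours.  If twisted (n − 1 ∈ S), the intended
  -- (n − 1)-colouring is ρ instead; ρ colours a₀ and bₙ₋₁ alike, hence Omitted below.
  π : ℕ → Pattern
  π r (a i) = i ⊓ r
  π r (b j) = j ⊓ suc r

  ρ : Pattern
  ρ (a i) = i ⊓ m
  ρ (b j) with j ≟ suc m
  ... | yes _ = 0
  ... | no _  = j ⊓ m

  ρ-b-last : ρ (b (suc m)) ≡ 0
  ρ-b-last with suc m ≟ suc m
  ... | yes _ = refl
  ... | no ≢  = contradiction refl ≢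

  ρ-b : ∀ {j} → j ≢ suc m → ρ (b j) ≡ j ⊓ m
  ρ-b {j} j≢ with j ≟ suc m
  ... | yes j≡ = contradiction j≡ j≢
  ... | no _   = refl

  Twisted : ℕ → Set
  Twisted r = T twisted × suc r ≡ m

  twisted? : ∀ r → Dec (Twisted r)
  twisted? r = T? twisted ×-dec (suc r ≟ m)

  intended : ℕ → Pattern
  intended r with twisted? r
  ... | yes _ = ρ
  ... | no _  = π r

  intended-elim : (P : Pattern → Set) → ∀ r → (¬ Twisted r → P (π r)) → (Twisted r → P ρ) → P (intended r)
  intended-elim P r plain twist with twisted? r
  ... | yes tw = twist tw
  ... | no ¬tw = plain ¬tw

  1≤m : T twisted → 1 ≤ m
  1≤m tw = s≤s⁻¹ (proj₁ (All.lookup S-bounds (1+m∈S tw)))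

  index≤m : ∀ {r} → suc (suc r) ∈ S → r ≤ m
  index≤m 2+r∈S = s≤s⁻¹ (s≤s⁻¹ (proj₂ (All.lookup S-bounds 2+r∈S)))

  π-ab : ∀ {r i} → i ≤ r → π r (a i) ≡ π r (b i)
  π-ab i≤r = trans (m≤n⇒m⊓n≡m i≤r) (sym (m≤n⇒m⊓n≡m (m≤n⇒m≤1+n i≤r)))

  π-aa : ∀ {r i j} → r ≤ i → r ≤ j → π r (a i) ≡ π r (a j)
  π-aa r≤i r≤j = trans (m≥n⇒m⊓n≡n r≤i) (sym (m≥n⇒m⊓n≡n r≤j))

  π-bb : ∀ {r i j} → suc r ≤ i → suc r ≤ j → π r (b i) ≡ π r (b j)
  π-bb r<i r<j = trans (m≥n⇒m⊓n≡n r<i) (sym (m≥n⇒m⊓n≡n r<j))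

  ρ-ab : ∀ {i} → i ≢ suc m → ρ (a i) ≡ ρ (b i)
  ρ-ab = sym ∘ ρ-b

  ρ-aa : ∀ {i j} → m ≤ i → m ≤ j → ρ (a i) ≡ ρ (a j)
  ρ-aa m≤i m≤j = trans (m≥n⇒m⊓n≡n m≤i) (sym (m≥n⇒m⊓n≡n m≤j))

  π-≤ : ∀ {r} u → π r u ≤ suc r
  π-≤ {r} (a i) = ≤-trans (m⊓n≤n i r) (n≤1+n r)
  π-≤ {r} (b j) = m⊓n≤n j (suc r)

  ρ-≤ : ∀ u → ρ u ≤ m
  ρ-≤ (a i) = m⊓n≤n i m
  ρ-≤ (b j) with j ≟ suc m
  ... | yes _ = z≤n
  ... | no _  = m⊓n≤n j m

  intended-< : ∀ r u → intended r u < suc (suc r)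
  intended-< r u = intended-elim (λ P → P u < suc (suc r)) r
    (λ _ → s≤s (π-≤ u))
    (λ (_ , 1+r≡m) → s≤s (subst (ρ u ≤_) (sym 1+r≡m) (ρ-≤ u)))

  colouring : ∀ r → Fin N → Fin (suc (suc r))
  colouring r x = fromℕ< (intended-< r (side x))

  toℕ-colouring : ∀ r x → toℕ (colouring r x) ≡ intended r (side x)
  toℕ-colouring r x = toℕ-fromℕ< _

  toℕ-colouring-vertex : ∀ r {u} → InRange u → toℕ (colouring r (vertex u)) ≡ intended r u
  toℕ-colouring-vertex r u∈ = trans (toℕ-colouring r _) (cong (intended r) (side-vertex u∈))

  intended-surjective : ∀ {r} → r ≤ m → ∀ {t} → t < suc (suc r) → ∃ λ u → InRange u × intended r u ≡ t
  intended-surjective {r} r≤m {t} t<2+r = intended-elim (λ P → ∃ λ u → InRange u × P u ≡ t) r π-hits ρ-hits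
    where
    π-hits : ¬ Twisted r → ∃ λ u → InRange u × π r u ≡ t
    π-hits _ = b t , ≤-trans t<2+r (s≤s (s≤s r≤m)) , m≤n⇒m⊓n≡m (s≤s⁻¹ t<2+r)
    ρ-hits : Twisted r → ∃ λ u → InRange u × ρ u ≡ t
    ρ-hits (_ , 1+r≡m) = a t , ≤-trans t<2+r (s≤s (s≤s (subst (r ≤_) 1+r≡m (n≤1+n r)))) ,
                         m≤n⇒m⊓n≡m (subst (t ≤_) 1+r≡m (s≤s⁻¹ t<2+r))

  Omitted : ℕ × ℕ → Set
  Omitted (i , j) = T twisted × i ≡ 0 × j ≡ suc m

  omitted? : ∀ p → Dec (Omitted p)
  omitted? (i , j) = T? twisted ×-dec (i ≟ 0) ×-dec (j ≟ suc m)

  ρ-separates : T twisted → ∀ {i j} → i < j → j < n → ¬ Omitted (i , j) → ρ (a i) ≢ ρ (b j)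
  ρ-separates tw {i} {j} i<j j<n ¬omitted with j ≟ suc m
  ... | yes j≡1+m = >⇒≢ (⊓-glb (n≢0⇒n>0 λ i≡0 → ¬omitted (tw , i≡0 , j≡1+m)) (1≤m tw))
  ... | no j≢1+m  = subst₂ _≢_ (sym (m≤n⇒m⊓n≡m (<⇒≤ (<-≤-trans i<j j≤m)))) (sym (m≤n⇒m⊓n≡m j≤m)) (<⇒≢ i<j)
    where j≤m = s≤s⁻¹ (≤∧≢⇒< (s≤s⁻¹ j<n) j≢1+m)

  intended-separates : ∀ r {i j} → i < j → j < n → ¬ Omitted (i , j) → intended r (a i) ≢ intended r (b j)
  intended-separates r {i} {j} i<j j<n ¬omitted = intended-elim (λ P → P (a i) ≢ P (b j)) r
    (λ _ → <⇒≢ (⊓-mono-< i<j (n<1+n r)))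
    (λ (tw , _) → ρ-separates tw i<j j<n ¬omitted)

  pairEdge : Vertex → Vertex → Subset N
  pairEdge u w = ⁅ vertex u ⁆ ∪ ⁅ vertex w ⁆

  edge : Vertex → Vertex → Vertex → Subset N
  edge u v w = ⁅ vertex u ⁆ ∪ pairEdge v w

  ∈-pairEdge⁻ : ∀ {u w x} → x ∈ₛ pairEdge u w → x ≡ vertex u ⊎ x ≡ vertex w
  ∈-pairEdge⁻ {u} {w} =
    Sum.map (Subset.x∈⁅y⁆⇒x≡y (vertex u)) (Subset.x∈⁅y⁆⇒x≡y (vertex w)) ∘ Subset.x∈p∪q⁻ _ _

  ∈-edge⁻ : ∀ {u v w x} → x ∈ₛ edge u v w → x ≡ vertex u ⊎ x ≡ vertex v ⊎ x ≡ vertex w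
  ∈-edge⁻ {u} {v} {w} = Sum.map (Subset.x∈⁅y⁆⇒x≡y (vertex u)) (∈-pairEdge⁻ {v} {w}) ∘ Subset.x∈p∪q⁻ _ _

  ∈-pairEdge₁ : ∀ {u w} → vertex u ∈ₛ pairEdge u w
  ∈-pairEdge₁ {u} = Subset.x∈p∪q⁺ (inj₁ (Subset.x∈⁅x⁆ (vertex u)))

  ∈-pairEdge₂ : ∀ {u w} → vertex w ∈ₛ pairEdge u w
  ∈-pairEdge₂ {u} {w} = Subset.x∈p∪q⁺ {p = ⁅ vertex u ⁆} (inj₂ (Subset.x∈⁅x⁆ (vertex w)))

  ∈-edge₁ : ∀ {u v w} → vertex u ∈ₛ edge u v w
  ∈-edge₁ {u} = Subset.x∈p∪q⁺ (inj₁ (Subset.x∈⁅x⁆ (vertex u)))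

  ∈-edge₂ : ∀ {u v w} → vertex v ∈ₛ edge u v w
  ∈-edge₂ {u} {v} {w} = Subset.x∈p∪q⁺ {p = ⁅ vertex u ⁆} (inj₂ (∈-pairEdge₁ {v} {w}))

  ∈-edge₃ : ∀ {u v w} → vertex w ∈ₛ edge u v w
  ∈-edge₃ {u} {v} {w} = Subset.x∈p∪q⁺ {p = ⁅ vertex u ⁆} (inj₂ (∈-pairEdge₂ {v} {w}))

  _≟ₛ_ : DecidableEquality (Subset N)
  _≟ₛ_ = ≡-dec Bool._≟_

  triple : Fin N × Fin N × Fin N → Subset N
  triple (x , y , z) = ⁅ x ⁆ ∪ (⁅ y ⁆ ∪ ⁅ z ⁆)

  triples : List (Subset N)
  triples = map triple (cartesianProduct (allFin N) (cartesianProduct (allFin N) (allFin N)))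

  edge-∈-triples : ∀ u v w → edge u v w ∈ triples
  edge-∈-triples u v w = ∈-map⁺ triple (∈-cartesianProduct⁺ (∈-allFin (vertex u))
                           (∈-cartesianProduct⁺ (∈-allFin (vertex v)) (∈-allFin (vertex w))))

  -- CEdgeOK depends on the hypergraph only through its order, so edgeless stands in for H
  -- while 𝒞 H is being defined.
  edgeless : MixedHypergraph
  edgeless = record { order = N ; 𝒞 = [] ; 𝒟 = [] ; 𝒞-unique = [] ; 𝒟-unique = [] }

  -- K ∸ 2 is the index r of K = 2 + r (every K ∈ S is at least 2).
  respected? : ∀ E → Dec (All (λ K → CEdgeOK edgeless (colouring (K ∸ 2)) E) S)
  respected? E = All.all? (λ K → CEdgeOK? edgeless (colouring (K ∸ 2)) E) S

  𝒟-pairs : List (ℕ × ℕ)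
  𝒟-pairs = filter (¬? ∘ omitted?) (pairs n)

  dEdge : ℕ × ℕ → Subset N
  dEdge (i , j) = pairEdge (a i) (b j)

  H : MixedHypergraph
  H = record
    { order = N
    ; 𝒞 = deduplicate _≟ₛ_ (filter respected? triples)
    ; 𝒟 = deduplicate _≟ₛ_ (map dEdge 𝒟-pairs)
    ; 𝒞-unique = deduplicate-! _≟ₛ_ _
    ; 𝒟-unique = deduplicate-! _≟ₛ_ _
    }

  colouring-𝒞 : ∀ {r} → suc (suc r) ∈ S → All (CEdgeOK H (colouring r)) (𝒞 H)
  colouring-𝒞 2+r∈S = All.tabulate λ E∈ →
    All.lookup (proj₂ (∈-filter⁻ respected? (∈-deduplicate⁻ _≟ₛ_ _ E∈))) 2+r∈S

  colouring-𝒟 : ∀ r → All (DEdgeOK H (colouring r)) (𝒟 H)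
  colouring-𝒟 r = All.tabulate λ E∈ → separated (∈-map⁻ dEdge (∈-deduplicate⁻ _≟ₛ_ _ E∈))
    where
    separated : ∀ {E} → ∃ (λ p → p ∈ 𝒟-pairs × E ≡ dEdge p) → DEdgeOK H (colouring r) E
    separated ((i , j) , p∈ , refl)
      with p∈pairs , ¬omitted ← ∈-filter⁻ (¬? ∘ omitted?) p∈
      with i<j , j<n ← ∈-pairs⁻ n p∈pairs =
      vertex (a i) , vertex (b j) , ∈-pairEdge₁ {a i} {b j} , ∈-pairEdge₂ {a i} {b j} ,
      λ eq → intended-separates r i<j j<n ¬omitted (begin
        intended r (a i)                    ≡⟨ toℕ-colouring-vertex r (<-trans i<j j<n) ⟨
        toℕ (colouring r (vertex (a i)))    ≡⟨ cong toℕ eq ⟩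
        toℕ (colouring r (vertex (b j)))    ≡⟨ toℕ-colouring-vertex r j<n ⟩
        intended r (b j)                    ∎)
      where open ≡-Reasoning

  colouring-surjective : ∀ {r} → suc (suc r) ∈ S → ∀ t → ∃ λ x → colouring r x ≡ t
  colouring-surjective {r} 2+r∈S t
    with u , u∈ , u↦t ← intended-surjective (index≤m 2+r∈S) (toℕ<n t) =
    vertex u , toℕ-injective (trans (toℕ-colouring-vertex r u∈) u↦t)

  colouring-strict : ∀ {r} → suc (suc r) ∈ S → Strict H (suc (suc r)) (colouring r)
  colouring-strict {r} 2+r∈S = (colouring-𝒞 2+r∈S , colouring-𝒟 r) , colouring-surjective 2+r∈S

  S-feasible : ∀ {K} → K ∈ S → Feasible H K
  S-feasible K∈S = feasible (proj₁ (All.lookup S-bounds K∈S)) K∈S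
    where
    feasible : ∀ {K} → 2 ≤ K → K ∈ S → Feasible H K
    feasible (s≤s (s≤s _)) K∈S = colouring _ , colouring-strict K∈S

  data Collides {B : Set} (f : Vertex → B) (u v w : Vertex) : Set where
    collide₁₂ : u ≢ v → f u ≡ f v → Collides f u v w
    collide₁₃ : u ≢ w → f u ≡ f w → Collides f u v w
    collide₂₃ : v ≢ w → f v ≡ f w → Collides f u v w

  monochromatic⇒CEdgeOK : ∀ {r E} x y → InRange x → InRange y → x ≢ y → intended r x ≡ intended r y →
                          vertex x ∈ₛ E → vertex y ∈ₛ E → CEdgeOK edgeless (colouring r) E
  monochromatic⇒CEdgeOK {r} x y x∈ y∈ x≢y eq x∈E y∈E =
    vertex x , vertex y , x∈E , y∈E , x≢y ∘ vertex-injective x∈ y∈ ,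
    toℕ-injective (trans (toℕ-colouring-vertex r x∈) (trans eq (sym (toℕ-colouring-vertex r y∈))))

  collides⇒CEdgeOK : ∀ {r} u v w → InRange u → InRange v → InRange w →
                     Collides (intended r) u v w → CEdgeOK edgeless (colouring r) (edge u v w)
  collides⇒CEdgeOK u v w u∈ v∈ w∈ (collide₁₂ u≢v eq) =
    monochromatic⇒CEdgeOK u v u∈ v∈ u≢v eq (∈-edge₁ {u} {v} {w}) (∈-edge₂ {u} {v} {w})
  collides⇒CEdgeOK u v w u∈ v∈ w∈ (collide₁₃ u≢w eq) =
    monochromatic⇒CEdgeOK u w u∈ w∈ u≢w eq (∈-edge₁ {u} {v} {w}) (∈-edge₃ {u} {v} {w})
  collides⇒CEdgeOK u v w u∈ v∈ w∈ (collide₂₃ v≢w eq) =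
    monochromatic⇒CEdgeOK v w v∈ w∈ v≢w eq (∈-edge₂ {u} {v} {w}) (∈-edge₃ {u} {v} {w})

  -- A record rather than a synonym, so that u v w can be inferred (vertex is not injective).
  record In𝒞 (u v w : Vertex) : Set where
    constructor in𝒞
    field edge∈𝒞 : edge u v w ∈ 𝒞 H

  collides⇒In𝒞 : ∀ u v w → InRange u → InRange v → InRange w →
                 (∀ {r} → suc (suc r) ∈ S → Collides (intended r) u v w) → In𝒞 u v w
  collides⇒In𝒞 u v w u∈ v∈ w∈ collides = in𝒞 $
    ∈-deduplicate⁺ _≟ₛ_ (∈-filter⁺ respected? (edge-∈-triples u v w)
      (All.tabulate λ K∈S → respected (proj₁ (All.lookup S-bounds K∈S)) K∈S))
    where
    respected : ∀ {K} → 2 ≤ K → K ∈ S → CEdgeOK edgeless (colouring (K ∸ 2)) (edge u v w)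
    respected (s≤s (s≤s _)) K∈S = collides⇒CEdgeOK u v w u∈ v∈ w∈ (collides K∈S)

  a≢a : ∀ {i j} → i ≢ j → a i ≢ a j
  a≢a i≢j refl = i≢j refl

  b≢b : ∀ {i j} → i ≢ j → b i ≢ b j
  b≢b i≢j refl = i≢j refl

  Plain : ℕ → Set
  Plain r = suc (suc r) ∈ S × ¬ Twisted r

  a₀b₀-∈𝒞 : In𝒞 (a 0) (b 0) (b 0)
  a₀b₀-∈𝒞 = collides⇒In𝒞 _ _ _ z<s z<s z<s λ {r} _ → intended-elim (λ P → Collides P (a 0) (b 0) (b 0)) r
    (λ _ → collide₁₂ (λ ()) (π-ab {r} z≤n))
    (λ _ → collide₁₂ (λ ()) (ρ-ab {0} (λ ())))

  aₘaₘ₊₁-∈𝒞 : In𝒞 (a m) (a (suc m)) (a (suc m))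
  aₘaₘ₊₁-∈𝒞 = collides⇒In𝒞 _ _ _ (m<n+m m z<s) (n<1+n (suc m)) (n<1+n (suc m)) λ {r} 2+r∈S →
    intended-elim (λ P → Collides P (a m) (a (suc m)) (a (suc m))) r
      (λ _ → collide₁₂ m≢1+m (π-aa (index≤m 2+r∈S) (m≤n⇒m≤1+n (index≤m 2+r∈S))))
      (λ _ → collide₁₂ m≢1+m (ρ-aa ≤-refl (n≤1+n m)))
    where m≢1+m = a≢a (<⇒≢ (n<1+n m))

  step-∈𝒞 : ∀ {t} → suc t < n → In𝒞 (a t) (a (suc t)) (b (suc t))
  step-∈𝒞 {t} 1+t<n = collides⇒In𝒞 _ _ _ (<-trans (n<1+n t) 1+t<n) 1+t<n 1+t<n λ {r} _ →
    intended-elim (λ P → Collides P (a t) (a (suc t)) (b (suc t))) r (λ _ → π-collides r) (λ _ → ρ-collides)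
    where
    t≢1+t = a≢a (<⇒≢ (n<1+n t))
    π-collides : ∀ r → Collides (π r) (a t) (a (suc t)) (b (suc t))
    π-collides r with suc t ≤? r
    ... | yes 1+t≤r = collide₂₃ (λ ()) (π-ab 1+t≤r)
    ... | no 1+t≰r  = collide₁₂ t≢1+t (π-aa r≤t (m≤n⇒m≤1+n r≤t))
      where r≤t = s≤s⁻¹ (≰⇒> 1+t≰r)
    ρ-collides : Collides ρ (a t) (a (suc t)) (b (suc t))
    ρ-collides with suc t ≟ suc m
    ... | yes 1+t≡1+m = collide₁₂ t≢1+t (ρ-aa (≤-reflexive (sym t≡m)) (m≤n⇒m≤1+n (≤-reflexive (sym t≡m))))
      where t≡m = suc-injective 1+t≡1+m
    ... | no 1+t≢1+m  = collide₂₃ (λ ()) (ρ-ab 1+t≢1+m)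

  aba-∈𝒞 : ∀ {i j} → i < j → j < n → In𝒞 (a i) (b i) (a j)
  aba-∈𝒞 {i} {j} i<j j<n = collides⇒In𝒞 _ _ _ i<n i<n j<n λ {r} _ →
    intended-elim (λ P → Collides P (a i) (b i) (a j)) r (λ _ → π-collides r)
      (λ _ → collide₁₂ (λ ()) (ρ-ab (<⇒≢ (<-≤-trans i<j (s≤s⁻¹ j<n)))))
    where
    i<n = <-trans i<j j<n
    π-collides : ∀ r → Collides (π r) (a i) (b i) (a j)
    π-collides r with i ≤? r
    ... | yes i≤r = collide₁₂ (λ ()) (π-ab i≤r)
    ... | no i≰r  = collide₁₃ (a≢a (<⇒≢ i<j)) (π-aa (<⇒≤ r<i) (<⇒≤ (<-trans r<i i<j)))
      where r<i = ≰⇒> i≰r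

  abb-∈𝒞 : ∀ {i j} → i < j → j < n → In𝒞 (a i) (b i) (b j)
  abb-∈𝒞 {i} {j} i<j j<n = collides⇒In𝒞 _ _ _ i<n i<n j<n λ {r} _ →
    intended-elim (λ P → Collides P (a i) (b i) (b j)) r (λ _ → π-collides r)
      (λ _ → collide₁₂ (λ ()) (ρ-ab (<⇒≢ (<-≤-trans i<j (s≤s⁻¹ j<n)))))
    where
    i<n = <-trans i<j j<n
    π-collides : ∀ r → Collides (π r) (a i) (b i) (b j)
    π-collides r with i ≤? r
    ... | yes i≤r = collide₁₂ (λ ()) (π-ab i≤r)
    ... | no i≰r  = collide₂₃ (b≢b (<⇒≢ i<j)) (π-bb r<i (<-trans r<i i<j))
      where r<i = ≰⇒> i≰r

  a₁b₁-∈𝒞 : ¬ Plain 0 → In𝒞 (a 1) (b 1) (b 1)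
  a₁b₁-∈𝒞 ¬plain = collides⇒In𝒞 _ _ _ 1<n 1<n 1<n λ {r} 2+r∈S →
    intended-elim (λ P → Collides P (a 1) (b 1) (b 1)) r
      (λ ¬tw → collide₁₂ (λ ()) (π-ab (n≢0⇒n>0 λ { refl → ¬plain (2+r∈S , ¬tw) })))
      (λ (tw , _) → collide₁₂ (λ ()) (ρ-ab (<⇒≢ (1≤m tw) ∘ suc-injective)))
    where 1<n = s≤s (s≤s z≤n)

  skip-∈𝒞 : ∀ {s} → suc (suc s) ≤ m → ¬ Plain (suc s) → In𝒞 (a s) (a (suc (suc s))) (b (suc (suc s)))
  skip-∈𝒞 {s} 2+s≤m ¬plain = collides⇒In𝒞 _ _ _ s<n 2+s<n 2+s<n λ {r} 2+r∈S →
    intended-elim (λ P → Collides P (a s) (a (suc (suc s))) (b (suc (suc s)))) r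
      (π-collides r 2+r∈S)
      (λ _ → collide₂₃ (λ ()) (ρ-ab (<⇒≢ (s≤s 2+s≤m))))
    where
    2+s<n = s≤s (m≤n⇒m≤1+n 2+s≤m)
    s<n = <-trans (<-trans (n<1+n s) (n<1+n (suc s))) 2+s<n
    π-collides : ∀ r → suc (suc r) ∈ S → ¬ Twisted r → Collides (π r) (a s) (a (suc (suc s))) (b (suc (suc s)))
    π-collides r 2+r∈S ¬tw with suc (suc s) ≤? r
    ... | yes 2+s≤r = collide₂₃ (λ ()) (π-ab 2+s≤r)
    ... | no 2+s≰r  = collide₁₂ (a≢a (<⇒≢ (≤-trans (n<1+n s) (n≤1+n (suc s))))) (π-aa r≤s (≤-trans r≤s (≤-trans (n≤1+n s) (n≤1+n (suc s)))))
      where r≤s = s≤s⁻¹ (≤∧≢⇒< (s≤s⁻¹ (≰⇒> 2+s≰r)) λ { refl → ¬plain (2+r∈S , ¬tw) })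

  ¬omitted-lo : ∀ {i j} → 1 ≤ i → ¬ Omitted (i , j)
  ¬omitted-lo 1≤i (_ , i≡0 , _) = <⇒≢ 1≤i (sym i≡0)

  ¬omitted-hi : ∀ {i j} → j < suc m → ¬ Omitted (i , j)
  ¬omitted-hi j<1+m (_ , _ , j≡1+m) = <⇒≢ j<1+m j≡1+m

  ¬omitted-step : ∀ {i} → ¬ Omitted (i , suc i)
  ¬omitted-step (tw , refl , 1≡1+m) = <⇒≢ (1≤m tw) (suc-injective 1≡1+m)

  intended-π : ∀ {r} → ¬ Twisted r → intended r ≡ π r
  intended-π {r} ¬tw = intended-elim (_≡ π r) r (λ _ → refl) (λ tw → contradiction tw ¬tw)

  intended-ρ : ∀ {r} → Twisted r → intended r ≡ ρ
  intended-ρ {r} tw = intended-elim (_≡ ρ) r (λ ¬tw → contradiction tw ¬tw) (λ _ → refl)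

  plain? : ∀ r → Dec (Plain r)
  plain? r = (suc (suc r) ∈? S) ×-dec ¬? (twisted? r)

  plain-m : Plain m
  plain-m = 2+m∈S , λ (_ , 1+m≡m) → 1+n≢n 1+m≡m

  dEdge-∈𝒟 : ∀ {i j} → i < j → j < n → ¬ Omitted (i , j) → dEdge (i , j) ∈ 𝒟 H
  dEdge-∈𝒟 i<j j<n ¬omitted =
    ∈-deduplicate⁺ _≟ₛ_ (∈-map⁺ dEdge (∈-filter⁺ (¬? ∘ omitted?) (∈-pairs⁺ n i<j j<n) ¬omitted))

  record Factorisation {K : ℕ} (c : Fin N → Fin K) : Set where
    field
      index             : ℕ
      index∈S           : suc (suc index) ∈ S
      relabel           : ℕ → Fin K
      relabel-injective : ∀ {u w} → u < suc (suc index) → w < suc (suc index) → relabel u ≡ relabel w → u ≡ w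
      factors           : ∀ {u} → InRange u → c (vertex u) ≡ relabel (intended index u)

  -- Recognising proper colourings

  module Recognition {K : ℕ} (c : Fin N → Fin K) (proper : Proper H K c) where

    γ : Vertex → Fin K
    γ u = c (vertex u)

    α β : ℕ → Fin K
    α i = γ (a i)
    β j = γ (b j)

    collision : ∀ {u v w} → In𝒞 u v w → Collides γ u v w
    collision {u} {v} {w} (in𝒞 E∈) = monochromatic-pair (All.lookup (proj₁ proper) E∈)
      where
      monochromatic-pair : CEdgeOK H c (edge u v w) → Collides γ u v w
      monochromatic-pair (x , y , x∈ , y∈ , x≢y , cx≡cy) =
        positions (∈-edge⁻ {u} {v} {w} x∈) (∈-edge⁻ {u} {v} {w} y∈)
        where
        apart : ∀ p q → x ≡ vertex p → y ≡ vertex q → p ≢ q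
        apart _ _ x≡ y≡ p≡q = x≢y (trans x≡ (trans (cong vertex p≡q) (sym y≡)))
        same : ∀ p q → x ≡ vertex p → y ≡ vertex q → γ p ≡ γ q
        same _ _ x≡ y≡ = trans (cong c (sym x≡)) (trans cx≡cy (cong c y≡))
        positions : x ≡ vertex u ⊎ x ≡ vertex v ⊎ x ≡ vertex w → y ≡ vertex u ⊎ y ≡ vertex v ⊎ y ≡ vertex w →
                    Collides γ u v w
        positions (inj₁ x≡u)        (inj₂ (inj₁ y≡v)) = collide₁₂ (apart u v x≡u y≡v) (same u v x≡u y≡v)
        positions (inj₁ x≡u)        (inj₂ (inj₂ y≡w)) = collide₁₃ (apart u w x≡u y≡w) (same u w x≡u y≡w)
        positions (inj₂ (inj₁ x≡v)) (inj₂ (inj₂ y≡w)) = collide₂₃ (apart v w x≡v y≡w) (same v w x≡v y≡w)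
        positions (inj₂ (inj₁ x≡v)) (inj₁ y≡u)        = collide₁₂ (≢-sym (apart v u x≡v y≡u)) (sym (same v u x≡v y≡u))
        positions (inj₂ (inj₂ x≡w)) (inj₁ y≡u)        = collide₁₃ (≢-sym (apart w u x≡w y≡u)) (sym (same w u x≡w y≡u))
        positions (inj₂ (inj₂ x≡w)) (inj₂ (inj₁ y≡v)) = collide₂₃ (≢-sym (apart w v x≡w y≡v)) (sym (same w v x≡w y≡v))
        positions (inj₁ x≡u)        (inj₁ y≡u)        = contradiction refl (apart u u x≡u y≡u)
        positions (inj₂ (inj₁ x≡v)) (inj₂ (inj₁ y≡v)) = contradiction refl (apart v v x≡v y≡v)
        positions (inj₂ (inj₂ x≡w)) (inj₂ (inj₂ y≡w)) = contradiction refl (apart w w x≡w y≡w)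

    collision-pair : ∀ {u w} → In𝒞 u w w → γ u ≡ γ w
    collision-pair E∈ = pair-collides (collision E∈)
      where
      pair-collides : ∀ {u w} → Collides γ u w w → γ u ≡ γ w
      pair-collides (collide₁₂ _ eq)  = eq
      pair-collides (collide₁₃ _ eq)  = eq
      pair-collides (collide₂₃ w≢w _) = contradiction refl w≢w

    separated : ∀ {i j} → i < j → j < n → ¬ Omitted (i , j) → α i ≢ β j
    separated {i} {j} i<j j<n ¬omitted αi≡βj = bichromatic (All.lookup (proj₂ proper) (dEdge-∈𝒟 i<j j<n ¬omitted))
      where
      colour : ∀ {z} → z ≡ vertex (a i) ⊎ z ≡ vertex (b j) → c z ≡ α i
      colour (inj₁ z≡) = cong c z≡
      colour (inj₂ z≡) = trans (cong c z≡) (sym αi≡βj)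
      bichromatic : ¬ DEdgeOK H c (dEdge (i , j))
      bichromatic (x , y , x∈ , y∈ , cx≢cy) =
        cx≢cy (trans (colour (∈-pairEdge⁻ {a i} {b j} x∈)) (sym (colour (∈-pairEdge⁻ {a i} {b j} y∈))))

    Threshold : ℕ → Set
    Threshold t′ = suc t′ < n × (∀ {i} → i < suc t′ → α i ≡ β i) × α (suc t′) ≢ β (suc t′)

    threshold : ∃ Threshold
    threshold = from-search (first-failure (λ i → α i Fin.≟ β i) n)
      where
      from-search : (∀ {i} → i < n → α i ≡ β i) ⊎ (∃ λ t → t < n × (∀ {i} → i < t → α i ≡ β i) × α t ≢ β t) →
                    ∃ Threshold
      from-search (inj₁ agree) = contradiction (trans (collision-pair aₘaₘ₊₁-∈𝒞) (agree (n<1+n (suc m))))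
                                   (separated (n<1+n m) (n<1+n (suc m)) ¬omitted-step)
      from-search (inj₂ (zero , _ , _ , α₀≢β₀))        = contradiction (collision-pair a₀b₀-∈𝒞) α₀≢β₀
      from-search (inj₂ (suc t′ , t<n , agree , split)) = t′ , t<n , agree , split

    -- If t′ is not plain, skip-∈𝒞 (or a₁b₁-∈𝒞) exhibits a triple made rainbow by c.
    no-gap : ∀ t′ → t′ < m → ¬ Plain t′ → α (suc t′) ≢ β (suc t′) →
             (∀ {u w} → u < w → w < suc t′ → α u ≢ α w) → (∀ {u} → u < suc t′ → α u ≢ β (suc t′)) →
             α (suc t′) ≡ α t′ → ⊥
    no-gap zero    _   ¬plain split _ _ _ = split (collision-pair (a₁b₁-∈𝒞 ¬plain))
    no-gap (suc s) s<m ¬plain split α-distinct α≢β α-step = impossible (collision (skip-∈𝒞 s<m ¬plain))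
      where
      impossible : Collides γ (a s) (a (suc (suc s))) (b (suc (suc s))) → ⊥
      impossible (collide₁₂ _ eq) = α-distinct (n<1+n s) (n<1+n (suc s)) (trans eq α-step)
      impossible (collide₁₃ _ eq) = α≢β (<-trans (n<1+n s) (n<1+n (suc s))) eq
      impossible (collide₂₃ _ eq) = split eq

    module AtThreshold (t′ : ℕ) (t<n : suc t′ < n) (agree : ∀ {i} → i < suc t′ → α i ≡ β i)
                       (split : α (suc t′) ≢ β (suc t′)) where

      open ≡-Reasoning

      t : ℕ
      t = suc t′

      α-distinct-below : ∀ {u w} → u < w → w < t → α u ≢ α w
      α-distinct-below u<w w<t αu≡αw =
        separated u<w (<-trans w<t t<n) (¬omitted-hi (<-≤-trans w<t (s≤s⁻¹ t<n))) (trans αu≡αw (agree w<t))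

      α-injective-below : ∀ {u w} → u < t → w < t → α u ≡ α w → u ≡ w
      α-injective-below {u} {w} u<t w<t = by-order (<-cmp u w)
        where
        by-order : Tri (u < w) (u ≡ w) (w < u) → α u ≡ α w → u ≡ w
        by-order (tri< u<w _ _) eq = contradiction eq (α-distinct-below u<w w<t)
        by-order (tri≈ _ u≡w _) _  = u≡w
        by-order (tri> _ _ w<u) eq = contradiction (sym eq) (α-distinct-below w<u u<t)

      α-t≡α-t′ : α t ≡ α t′
      α-t≡α-t′ = from-collision (collision (step-∈𝒞 t<n))
        where
        from-collision : Collides γ (a t′) (a t) (b t) → α t ≡ α t′
        from-collision (collide₁₂ _ eq) = sym eq
        from-collision (collide₁₃ _ eq) = contradiction eq (separated (n<1+n t′) t<n ¬omitted-step)
        from-collision (collide₂₃ _ eq) = contradiction eq split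

      β-beyond : ∀ {j} → t < j → j < n → β j ≡ β t
      β-beyond {j} t<j j<n = from-collision (collision (abb-∈𝒞 t<j j<n))
        where
        from-collision : Collides γ (a t) (b t) (b j) → β j ≡ β t
        from-collision (collide₁₂ _ eq) = contradiction eq split
        from-collision (collide₁₃ _ eq) = contradiction eq (separated t<j j<n (¬omitted-lo (s≤s z≤n)))
        from-collision (collide₂₃ _ eq) = sym eq

      α-beyond-≢β : ∀ {j} → t < j → j < n → α j ≢ β t
      α-beyond-≢β t<j j<n = by-position t<j (m<1+n⇒m<n∨m≡n j<n)
        where
        before-last : ∀ {j} → t < j → j < suc m → α j ≢ β t
        before-last t<j j<1+m eq = separated j<1+m (n<1+n (suc m)) (¬omitted-lo (≤-trans (s≤s z≤n) (<⇒≤ t<j)))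
                                     (trans eq (sym (β-beyond (<-trans t<j j<1+m) (n<1+n (suc m)))))
        α-m≢β-t : t ≤ m → α m ≢ β t
        α-m≢β-t t≤m with m≤n⇒m<n∨m≡n t≤m
        ... | inj₁ t<m  = before-last t<m (n<1+n m)
        ... | inj₂ refl = split
        by-position : ∀ {j} → t < j → j < suc m ⊎ j ≡ suc m → α j ≢ β t
        by-position t<j (inj₁ j<1+m) = before-last t<j j<1+m
        by-position t<j (inj₂ refl)  = α-m≢β-t (s≤s⁻¹ t<j) ∘ trans (collision-pair aₘaₘ₊₁-∈𝒞)

      α-beyond : ∀ {j} → t < j → j < n → α j ≡ α t
      α-beyond {j} t<j j<n = from-collision (collision (aba-∈𝒞 t<j j<n))
        where
        from-collision : Collides γ (a t) (b t) (a j) → α j ≡ α t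
        from-collision (collide₁₂ _ eq) = contradiction eq split
        from-collision (collide₁₃ _ eq) = sym eq
        from-collision (collide₂₃ _ eq) = contradiction (sym eq) (α-beyond-≢β t<j j<n)

      α-from : ∀ {j} → t ≤ j → j < n → α j ≡ α t
      α-from t≤j j<n = [ (λ t<j → α-beyond t<j j<n) , (λ t≡j → cong α (sym t≡j)) ]′ (m≤n⇒m<n∨m≡n t≤j)

      β-from : ∀ {j} → t ≤ j → j < n → β j ≡ β t
      β-from t≤j j<n = [ (λ t<j → β-beyond t<j j<n) , (λ t≡j → cong β (sym t≡j)) ]′ (m≤n⇒m<n∨m≡n t≤j)

      -- The only configuration in which no 𝒟-edge separates some α u, u < t, from β t.
      TwistShaped : Set
      TwistShaped = Omitted (0 , t) × α 0 ≡ β t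

      α-below-≢β : ¬ TwistShaped → ∀ {u} → u < t → α u ≢ β t
      α-below-≢β ¬twist {u} u<t αu≡βt = by-omission (omitted? (u , t))
        where
        by-omission : Dec (Omitted (u , t)) → ⊥
        by-omission (yes (tw , u≡0 , t≡1+m)) = ¬twist ((tw , refl , t≡1+m) , subst (λ k → α k ≡ β t) u≡0 αu≡βt)
        by-omission (no ¬omitted)             = separated u<t t<n ¬omitted αu≡βt

      relabel : ℕ → Fin K
      relabel u = if does (u <? t) then α u else β t

      relabel-below : ∀ {u} → u < t → relabel u ≡ α u
      relabel-below {u} u<t = cong (if_then α u else β t) (dec-true (u <? t) u<t)

      relabel-t : relabel t ≡ β t
      relabel-t = cong (if_then α t else β t) (dec-false (t <? t) (<-irrefl refl))

      π-factors : ∀ {u} → InRange u → γ u ≡ relabel (π t′ u)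
      π-factors {a i} i<n = [ below , above ]′ (≤-<-connex i t′)
        where
        below : i ≤ t′ → α i ≡ relabel (i ⊓ t′)
        below i≤t′ = begin
          α i              ≡⟨ relabel-below (s≤s i≤t′) ⟨
          relabel i        ≡⟨ cong relabel (m≤n⇒m⊓n≡m i≤t′) ⟨
          relabel (i ⊓ t′) ∎
        above : t′ < i → α i ≡ relabel (i ⊓ t′)
        above t≤i = begin
          α i              ≡⟨ α-from t≤i i<n ⟩
          α t              ≡⟨ α-t≡α-t′ ⟩
          α t′             ≡⟨ relabel-below (n<1+n t′) ⟨
          relabel t′       ≡⟨ cong relabel (m≥n⇒m⊓n≡n (<⇒≤ t≤i)) ⟨
          relabel (i ⊓ t′) ∎
      π-factors {b j} j<n = [ below , above ]′ (≤-<-connex j t′)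
        where
        below : j ≤ t′ → β j ≡ relabel (j ⊓ t)
        below j≤t′ = begin
          β j              ≡⟨ agree (s≤s j≤t′) ⟨
          α j              ≡⟨ relabel-below (s≤s j≤t′) ⟨
          relabel j        ≡⟨ cong relabel (m≤n⇒m⊓n≡m (m≤n⇒m≤1+n j≤t′)) ⟨
          relabel (j ⊓ t)  ∎
        above : t′ < j → β j ≡ relabel (j ⊓ t)
        above t≤j = begin
          β j              ≡⟨ β-from t≤j j<n ⟩
          β t              ≡⟨ relabel-t ⟨
          relabel t        ≡⟨ cong relabel (m≥n⇒m⊓n≡n t≤j) ⟨
          relabel (j ⊓ t)  ∎

      plain-factorisation : ¬ TwistShaped → Plain t′ → Factorisation c
      plain-factorisation ¬twist (2+t′∈S , ¬tw) = record
        { index             = t′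
        ; index∈S           = 2+t′∈S
        ; relabel           = relabel
        ; relabel-injective = injective-up-to-suc
            (λ u<t w<t eq → α-injective-below u<t w<t
              (trans (sym (relabel-below u<t)) (trans eq (relabel-below w<t))))
            (λ u<t eq → α-below-≢β ¬twist u<t (trans (sym (relabel-below u<t)) (trans eq relabel-t)))
        ; factors           = λ {u} u∈ → trans (π-factors u∈) (cong (λ P → relabel (P u)) (sym (intended-π ¬tw)))
        }

      twisted-factorisation : TwistShaped → Factorisation c
      twisted-factorisation ((tw , _ , t≡1+m) , α₀≡βt) = record
        { index             = pred m
        ; index∈S           = subst (λ k → suc k ∈ S) (sym 1+pred-m) (1+m∈S tw)
        ; relabel           = α
        ; relabel-injective = λ {u} {w} u<2+r w<2+r → α-injective-below (subst (u <_) 2+pred-m≡t u<2+r)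
                                                                        (subst (w <_) 2+pred-m≡t w<2+r)
        ; factors           = λ {u} u∈ → trans (ρ-factors u∈) (cong (λ P → α (P u)) (sym (intended-ρ (tw , 1+pred-m))))
        }
        where
        1+pred-m : suc (pred m) ≡ m
        1+pred-m = suc-pred m {{>-nonZero (1≤m tw)}}
        2+pred-m≡t : suc (suc (pred m)) ≡ t
        2+pred-m≡t = trans (cong suc 1+pred-m) (sym t≡1+m)
        a-factors : ∀ {i} → i ≤ m ⊎ i ≡ suc m → α i ≡ α (ρ (a i))
        a-factors (inj₁ i≤m)  = cong α (sym (m≤n⇒m⊓n≡m i≤m))
        a-factors (inj₂ refl) = trans (sym (collision-pair aₘaₘ₊₁-∈𝒞)) (cong α (sym (m≥n⇒m⊓n≡n (n≤1+n m))))
        b-factors : ∀ {j} → j < suc m ⊎ j ≡ suc m → β j ≡ α (ρ (b j))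
        b-factors {j} (inj₁ j<1+m) = begin
          β j              ≡⟨ agree (subst (j <_) (sym t≡1+m) j<1+m) ⟨
          α j              ≡⟨ cong α (m≤n⇒m⊓n≡m (s≤s⁻¹ j<1+m)) ⟨
          α (j ⊓ m)        ≡⟨ cong α (ρ-b (<⇒≢ j<1+m)) ⟨
          α (ρ (b j))      ∎
        b-factors (inj₂ refl)  = begin
          β (suc m)        ≡⟨ cong β t≡1+m ⟨
          β t              ≡⟨ α₀≡βt ⟨
          α 0              ≡⟨ cong α ρ-b-last ⟨
          α (ρ (b (suc m))) ∎
        ρ-factors : ∀ {u} → InRange u → γ u ≡ α (ρ u)
        ρ-factors {a i} i<n = a-factors (Sum.map₁ s≤s⁻¹ (m<1+n⇒m<n∨m≡n i<n))
        ρ-factors {b j} j<n = b-factors (m<1+n⇒m<n∨m≡n j<n)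

      t′<m : ¬ Plain t′ → t′ < m
      t′<m ¬plain = ≤∧≢⇒< (s≤s⁻¹ (s≤s⁻¹ t<n)) (λ t′≡m → ¬plain (subst Plain (sym t′≡m) plain-m))

      factorisation : Factorisation c
      factorisation = by-shape (omitted? (0 , t) ×-dec (α 0 Fin.≟ β t)) (plain? t′)
        where
        by-shape : Dec TwistShaped → Dec (Plain t′) → Factorisation c
        by-shape (yes twist) _            = twisted-factorisation twist
        by-shape (no ¬twist) (yes plain)  = plain-factorisation ¬twist plain
        by-shape (no ¬twist) (no ¬plain)  = ⊥-elim (no-gap t′ (t′<m ¬plain) ¬plain split α-distinct-below
                                                       (α-below-≢β ¬twist) α-t≡α-t′)

    recognise : Factorisation c
    recognise = let t′ , t<n , agree , split = threshold in AtThreshold.factorisation t′ t<n agree split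

  module _ {K : ℕ} {c : Fin N → Fin K} (f : Factorisation c) where
    open Factorisation f

    factors-everywhere : ∀ x → c x ≡ relabel (intended index (side x))
    factors-everywhere x = trans (cong c (sym (vertex-side x))) (factors (side-inRange x))

    factorisation-partition : SamePartition H c (colouring index)
    factorisation-partition x y = mk⇔ to from
      where
      open ≡-Reasoning
      to : c x ≡ c y → colouring index x ≡ colouring index y
      to eq = toℕ-injective (begin
        toℕ (colouring index x)  ≡⟨ toℕ-colouring index x ⟩
        intended index (side x)  ≡⟨ relabel-injective (intended-< index (side x)) (intended-< index (side y))
                                      (trans (sym (factors-everywhere x)) (trans eq (factors-everywhere y))) ⟩
        intended index (side y)  ≡⟨ toℕ-colouring index y ⟨
        toℕ (colouring index y)  ∎)
      from : colouring index x ≡ colouring index y → c x ≡ c y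
      from eq = begin
        c x                                ≡⟨ factors-everywhere x ⟩
        relabel (intended index (side x))  ≡⟨ cong relabel (trans (sym (toℕ-colouring index x))
                                                (trans (cong toℕ eq) (toℕ-colouring index y))) ⟩
        relabel (intended index (side y))  ≡⟨ factors-everywhere y ⟨
        c y                                ∎

    factorisation-colours : (∀ j → ∃ λ x → c x ≡ j) → K ≡ suc (suc index)
    factorisation-colours c-surjective = ≤-antisym
      (surjective-factor⇒≤ c (colouring index) c-surjective
        (λ x y → Equivalence.from (factorisation-partition x y)))
      (surjective-factor⇒≤ (colouring index) c (colouring-surjective index∈S)
        (λ x y → Equivalence.to (factorisation-partition x y)))

  realises : OneRealization H S
  realises = (λ k → mk⇔ feasible⇒∈S S-feasible) , λ k k∈S → S-feasible k∈S , same-partition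
    where
    recognised : ∀ {k} {c : Fin N → Fin k} → Strict H k c → Factorisation c
    recognised {c = c} strict = Recognition.recognise c (proj₁ strict)
    feasible⇒∈S : ∀ {k} → Feasible H k → k ∈ S
    feasible⇒∈S (c , strict) = subst (_∈ S) (sym (factorisation-colours (recognised strict) (proj₂ strict)))
                                 (Factorisation.index∈S (recognised strict))
    same-partition : ∀ {k} (c c′ : Fin N → Fin k) → Strict H k c → Strict H k c′ → SamePartition H c c′
    same-partition c c′ strict strict′ x y =
      ⇔-trans (factorisation-partition f x y)
              (subst (λ r → (colouring r x ≡ colouring r y) ⇔ (c′ x ≡ c′ y)) (sym same-index)
                     (⇔-sym (factorisation-partition f′ x y)))
      where
      f = recognised strict
      f′ = recognised strict′
      same-index : Factorisation.index f ≡ Factorisation.index f′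
      same-index = suc-injective (suc-injective
        (trans (sym (factorisation-colours f (proj₂ strict))) (factorisation-colours f′ (proj₂ strict′))))

  #𝒟≤𝒟-pairs : #𝒟 H ≤ length 𝒟-pairs
  #𝒟≤𝒟-pairs = ≤-trans (length-deduplicate _≟ₛ_ (map dEdge 𝒟-pairs)) (≤-reflexive (length-map dEdge 𝒟-pairs))

  #𝒟≤pairs : #𝒟 H ≤ length (pairs n)
  #𝒟≤pairs = ≤-trans #𝒟≤𝒟-pairs (length-filter (¬? ∘ omitted?) (pairs n))

  #𝒟<pairs : T twisted → #𝒟 H < length (pairs n)
  #𝒟<pairs tw = ≤-<-trans #𝒟≤𝒟-pairs (filter-notAll (¬? ∘ omitted?) (pairs n)
    (Any.map (λ { refl ¬omitted → ¬omitted (tw , refl , refl) }) (∈-pairs⁺ n z<s (n<1+n (suc m)))))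

δ𝒟-is-intro : ∀ {S d} H → OneRealization H S → #𝒟 H ≤ d →
              (∀ H′ → OneRealization H′ S → d ≤ #𝒟 H′) → δ𝒟-is S d
δ𝒟-is-intro H realises #𝒟≤d minimal = (H , realises , ≤-antisym #𝒟≤d (minimal H realises)) , minimal

head-maximal : ∀ {x xs} → Linked _>_ (x ∷ xs) → All (_≤ x) (x ∷ xs)
head-maximal [-]           = ≤-refl ∷ []
head-maximal (x>y ∷ linked) = ≤-refl ∷ All.map <⇒≤ (Linked⇒All (flip <-trans) x>y linked)

theorem1p1 : (n₁ : ℕ) (rest : List ℕ) →
    Linked _>_ (n₁ ∷ rest) →
    All (2 ≤_) (n₁ ∷ rest) →
    ((n₁ ∸ 1) ∉ (n₁ ∷ rest) → δ𝒟-is (n₁ ∷ rest) ((n₁ * (n₁ ∸ 1)) / 2))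
    × ((n₁ ∸ 1) ∈ (n₁ ∷ rest) → δ𝒟-is (n₁ ∷ rest) ((n₁ * (n₁ ∸ 1)) / 2 ∸ 1))
theorem1p1 zero          _    _      (() ∷ _)
theorem1p1 (suc zero)    _    _      (s≤s () ∷ _)
theorem1p1 (suc (suc m)) rest linked 2≤S = untwisted , twisted
  where
  S = suc (suc m) ∷ rest
  n = suc (suc m)
  bounds = All.zip (2≤S , head-maximal linked)
  untwisted : suc m ∉ S → δ𝒟-is S (n * (n ∸ 1) / 2)
  untwisted 1+m∉S rewrite sym (length-pairs n) =
    δ𝒟-is-intro C.H C.realises C.#𝒟≤pairs
      λ H′ realises′ → LowerBound.pairs≤#𝒟 {S} {H′} realises′ (suc m) (here refl) 1+m∉S
    where module C = Construction m S false bounds (here refl) (λ ())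
  twisted : suc m ∈ S → δ𝒟-is S (n * (n ∸ 1) / 2 ∸ 1)
  twisted 1+m∈S rewrite sym (length-pairs n) =
    δ𝒟-is-intro C.H C.realises (∸-monoˡ-≤ 1 (C.#𝒟<pairs tt))
      λ H′ realises′ → ∸-monoˡ-≤ 1 (LowerBound.pairs≤1+#𝒟 {S} {H′} realises′ (suc m) (here refl) 1+m∈S)
    where module C = Construction m S true bounds (here refl) (λ _ → 1+m∈S)
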